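{- For every non-negative integer $n$, \[ \sum_{r=-n}^{n}\frac{(-1)^r}{(2n+2r+1)!\,(2n-2r+1)!}=\frac{2^{2n+1}}{(4n+2)!}. \] -}

module Defs where

open import Data.Nat as ℕ using (ℕ; suc; _!)
open import Data.Nat.Properties using (_!*_!≢0; _!≢0)
open import Data.Integer as ℤ using (ℤ; +_; ∣_∣)
open import Data.Rational as ℚ using (ℚ; _/_; 1ℚ; 0ℚ; -_; _+_; _*_)
open import Data.List using (List; map; foldr; upTo)

signℤ : ℤ → ℚ
signℤ r with ∣ r ∣ ℕ.% 2
... | 0 = 1ℚ
... | _ = - 1ℚ

range : ℕ → List ℤ
range n = map (λ k → + k ℤ.- + n) (upTo (suc (2 ℕ.* n)))

-- the summand  (-1)^r / ((2n+2r+1)! (2n-2r+1)!)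
-- For r ∈ [-n, n] both factorial arguments are non-negative integers; ∣_∣ converts them to ℕ.
term : ℕ → ℤ → ℚ
term n r = signℤ r * (+ 1 / (a ! ℕ.* b !))
  where
  a = ∣ + (2 ℕ.* n) ℤ.+ + 2 ℤ.* r ℤ.+ + 1 ∣
  b = ∣ + (2 ℕ.* n) ℤ.- + 2 ℤ.* r ℤ.+ + 1 ∣
  instance _ = a !* b !≢0

sumℚ : List ℚ → ℚ
sumℚ = foldr _+_ 0ℚ

LHS : ℕ → ℚ
LHS n = sumℚ (map (term n) (range n))

RHS : ℕ → ℚ
RHS n = + (2 ℕ.^ (2 ℕ.* n ℕ.+ 1)) / ((4 ℕ.* n ℕ.+ 2) !)
  where instance _ = (4 ℕ.* n ℕ.+ 2) !≢0

-- Multiplied by (4n+2)!, the identity reads Σ_j (-1)^(j-n) C(4n+2, 2j+1) = 2^(2n+1), with j = r + n.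
-- Up to the sign (-1)^n the left side is the imaginary part of (1 + i)^(4n+2) = (2i)^(2n+1), which is
-- (-1)^n 2^(2n+1). No complex numbers are needed: Im (i^s (1 + i)^m) = Σ_k C(m,k) Im (i^(s+k)) satisfies
-- Pascal's recursion in m, two steps of which multiply by (1 + i)^2 = 2i, and the terms with s + k even
-- vanish because Im (i^(2q)) = 0.
module Submission where

open import Defs
open import Data.Nat as ℕ using (ℕ; zero; suc; _!; _∸_; _≤_; _<_; NonZero)
open import Data.Nat.Properties as ℕ using (_!≢0; _!*_!≢0)
import Data.Nat.Tactic.RingSolver as ℕ-Solver
open import Data.Nat.Combinatorics using (_C_; nCk+nC[k+1]≡[n+1]C[k+1]; k>n⇒nCk≡0; nCk≡n!/k![n-k]!; k![n∸k]!∣n!)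
open import Data.Nat.DivMod using (m/n*n≡m)
open import Data.Integer as ℤ using (ℤ; +_; -[1+_]; _+_; _-_; _*_; -_; _⊖_; 0ℤ; 1ℤ)
import Data.Integer.Properties as ℤ
open import Data.Integer.Tactic.RingSolver using (solve-∀)
open import Data.Rational as ℚ using (ℚ; _/_; toℚᵘ)
open import Data.Rational.Properties using (toℚᵘ-injective; toℚᵘ-fromℚᵘ; toℚᵘ-homo-+; toℚᵘ-homo-*; 0/n≡0)
open import Data.Rational.Unnormalised as ℚᵘ using (mkℚᵘ; *≡*)
import Data.Rational.Unnormalised.Properties as ℚᵘ
open import Data.List using (map; applyUpTo; upTo)
open import Data.List.Properties using (map-∘)
open import Function using (_∘_; id)
open import Relation.Binary.PropositionalEquality
open ≡-Reasoning

Im-i^ : ℕ → ℤ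
Im-i^ 0 = 0ℤ
Im-i^ 1 = 1ℤ
Im-i^ 2 = 0ℤ
Im-i^ 3 = -[1+ 0 ]
Im-i^ (suc (suc (suc (suc k)))) = Im-i^ k

Im-i^-2+ : ∀ k → Im-i^ (2 ℕ.+ k) ≡ - Im-i^ k
Im-i^-2+ 0 = refl
Im-i^-2+ 1 = refl
Im-i^-2+ 2 = refl
Im-i^-2+ 3 = refl
Im-i^-2+ (suc (suc (suc (suc k)))) = Im-i^-2+ k

Im-i^-4*+ : ∀ q r → Im-i^ (4 ℕ.* q ℕ.+ r) ≡ Im-i^ r
Im-i^-4*+ zero    r = refl
Im-i^-4*+ (suc q) r = trans (cong Im-i^ (4*[1+q]+r q r)) (Im-i^-4*+ q r)
  where
  4*[1+q]+r : ∀ q r → 4 ℕ.* suc q ℕ.+ r ≡ 4 ℕ.+ (4 ℕ.* q ℕ.+ r)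
  4*[1+q]+r = ℕ-Solver.solve-∀

Im-i^-2* : ∀ q → Im-i^ (2 ℕ.* q) ≡ 0ℤ
Im-i^-2* zero    = refl
Im-i^-2* (suc q) = begin
  Im-i^ (2 ℕ.* suc q)       ≡⟨ cong Im-i^ (2*[1+q] q) ⟩
  Im-i^ (2 ℕ.+ 2 ℕ.* q)     ≡⟨ Im-i^-2+ (2 ℕ.* q) ⟩
  - Im-i^ (2 ℕ.* q)         ≡⟨ cong -_ (Im-i^-2* q) ⟩
  0ℤ                        ∎
  where
  2*[1+q] : ∀ q → 2 ℕ.* suc q ≡ 2 ℕ.+ 2 ℕ.* q
  2*[1+q] = ℕ-Solver.solve-∀

∑< : ℕ → (ℕ → ℤ) → ℤ
∑< zero    f = 0ℤ
∑< (suc m) f = f 0 + ∑< m (f ∘ suc)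

syntax ∑< m (λ k → e) = ∑[ k < m ] e

∑-cong : ∀ {f g : ℕ → ℤ} m → (∀ k → f k ≡ g k) → ∑[ k < m ] f k ≡ ∑[ k < m ] g k
∑-cong zero    f≗g = refl
∑-cong (suc m) f≗g = cong₂ _+_ (f≗g 0) (∑-cong m (f≗g ∘ suc))

∑-init-last : ∀ (f : ℕ → ℤ) m → ∑[ k < suc m ] f k ≡ ∑[ k < m ] f k + f m
∑-init-last f zero    = trans (ℤ.+-identityʳ (f 0)) (sym (ℤ.+-identityˡ (f 0)))
∑-init-last f (suc m) = trans (cong (_+_ (f 0)) (∑-init-last (f ∘ suc) m)) (sym (ℤ.+-assoc (f 0) _ _))

∑-distrib-+ : ∀ (f g : ℕ → ℤ) m → ∑[ k < m ] (f k + g k) ≡ ∑[ k < m ] f k + ∑[ k < m ] g k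
∑-distrib-+ f g zero    = refl
∑-distrib-+ f g (suc m) = begin
  f 0 + g 0 + ∑[ k < m ] (f (suc k) + g (suc k))
    ≡⟨ cong (_+_ (f 0 + g 0)) (∑-distrib-+ (f ∘ suc) (g ∘ suc) m) ⟩
  f 0 + g 0 + (∑[ k < m ] f (suc k) + ∑[ k < m ] g (suc k))
    ≡⟨ medial (f 0) (g 0) _ _ ⟩
  f 0 + ∑[ k < m ] f (suc k) + (g 0 + ∑[ k < m ] g (suc k)) ∎
  where
  medial : ∀ a b c d → a + b + (c + d) ≡ a + c + (b + d)
  medial = solve-∀

∑-distrib-neg : ∀ (f : ℕ → ℤ) m → ∑[ k < m ] (- f k) ≡ - ∑[ k < m ] f k
∑-distrib-neg f zero    = refl
∑-distrib-neg f (suc m) = trans (cong (_+_ (- f 0)) (∑-distrib-neg (f ∘ suc) m)) (sym (ℤ.neg-distrib-+ (f 0) _))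

∑-pairs : ∀ (f : ℕ → ℤ) m → ∑[ k < 2 ℕ.* m ] f k ≡ ∑[ j < m ] (f (2 ℕ.* j) + f (suc (2 ℕ.* j)))
∑-pairs f zero    = refl
∑-pairs f (suc m) = begin
  ∑[ k < 2 ℕ.* suc m ] f k
    ≡⟨ cong (λ l → ∑[ k < l ] f k) (ℕ.*-suc 2 m) ⟩
  f 0 + (f 1 + ∑[ k < 2 ℕ.* m ] f (2 ℕ.+ k))
    ≡⟨ sym (ℤ.+-assoc (f 0) (f 1) _) ⟩
  f 0 + f 1 + ∑[ k < 2 ℕ.* m ] f (2 ℕ.+ k)
    ≡⟨ cong (_+_ (f 0 + f 1)) (∑-pairs (f ∘ suc ∘ suc) m) ⟩
  f 0 + f 1 + ∑[ j < m ] (f (2 ℕ.+ 2 ℕ.* j) + f (3 ℕ.+ 2 ℕ.* j))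
    ≡⟨ cong (_+_ (f 0 + f 1)) (∑-cong m (λ j → cong (λ i → f i + f (suc i)) (sym (ℕ.*-suc 2 j)))) ⟩
  f 0 + f 1 + ∑[ j < m ] (f (2 ℕ.* suc j) + f (suc (2 ℕ.* suc j))) ∎

∑-binomial-extend : ∀ (g : ℕ → ℤ) m → ∑[ k < suc m ] (+ (m C k) * g k) ≡ ∑[ k < 2 ℕ.+ m ] (+ (m C k) * g k)
∑-binomial-extend g m = sym (begin
  ∑[ k < 2 ℕ.+ m ] (+ (m C k) * g k)
    ≡⟨ ∑-init-last (λ k → + (m C k) * g k) (suc m) ⟩
  ∑[ k < suc m ] (+ (m C k) * g k) + + (m C suc m) * g (suc m)
    ≡⟨ cong (λ c → ∑[ k < suc m ] (+ (m C k) * g k) + + c * g (suc m)) (k>n⇒nCk≡0 (ℕ.n<1+n m)) ⟩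
  ∑[ k < suc m ] (+ (m C k) * g k) + 0ℤ
    ≡⟨ ℤ.+-identityʳ _ ⟩
  ∑[ k < suc m ] (+ (m C k) * g k) ∎)

∑-pascal : ∀ (g : ℕ → ℤ) m →
  ∑[ k < 2 ℕ.+ m ] (+ (suc m C k) * g k) ≡ ∑[ k < suc m ] (+ (m C k) * g k) + ∑[ k < suc m ] (+ (m C k) * g (suc k))
∑-pascal g m = begin
  + 1 * g 0 + ∑[ k < suc m ] (+ (suc m C suc k) * g (suc k))
    ≡⟨ cong (_+_ (+ 1 * g 0)) (∑-cong (suc m) pascal) ⟩
  + 1 * g 0 + ∑[ k < suc m ] (+ (m C k) * g (suc k) + + (m C suc k) * g (suc k))
    ≡⟨ cong (_+_ (+ 1 * g 0)) (∑-distrib-+ (λ k → + (m C k) * g (suc k)) (λ k → + (m C suc k) * g (suc k)) (suc m)) ⟩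
  + 1 * g 0 + (X + Y)
    ≡⟨ shuffle (+ 1 * g 0) X Y ⟩
  + 1 * g 0 + Y + X
    ≡⟨ cong (_+ X) (sym (∑-binomial-extend g m)) ⟩
  ∑[ k < suc m ] (+ (m C k) * g k) + X ∎
  where
  X = ∑[ k < suc m ] (+ (m C k) * g (suc k))
  Y = ∑[ k < suc m ] (+ (m C suc k) * g (suc k))
  pascal : ∀ k → + (suc m C suc k) * g (suc k) ≡ + (m C k) * g (suc k) + + (m C suc k) * g (suc k)
  pascal k = begin
    + (suc m C suc k) * g (suc k)             ≡⟨ cong (λ c → + c * g (suc k)) (sym (nCk+nC[k+1]≡[n+1]C[k+1] m k)) ⟩
    + (m C k ℕ.+ m C suc k) * g (suc k)       ≡⟨ ℤ.*-distribʳ-+ (g (suc k)) (+ (m C k)) (+ (m C suc k)) ⟩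
    + (m C k) * g (suc k) + + (m C suc k) * g (suc k) ∎
  shuffle : ∀ a x y → a + (x + y) ≡ a + y + x
  shuffle = solve-∀

-- Im (i ^ s * (1 + i) ^ m), expanded by the binomial theorem
binomialIm : ℕ → ℕ → ℤ
binomialIm s m = ∑[ k < suc m ] (+ (m C k) * Im-i^ (s ℕ.+ k))

binomialIm-suc : ∀ s m → binomialIm s (suc m) ≡ binomialIm s m + binomialIm (suc s) m
binomialIm-suc s m = trans (∑-pascal (λ k → Im-i^ (s ℕ.+ k)) m)
  (cong (_+_ (binomialIm s m)) (∑-cong (suc m) (λ k → cong (λ i → + (m C k) * Im-i^ i) (ℕ.+-suc s k))))

binomialIm-2+ : ∀ s m → binomialIm (2 ℕ.+ s) m ≡ - binomialIm s m
binomialIm-2+ s m = trans (∑-cong (suc m) negate) (∑-distrib-neg (λ k → + (m C k) * Im-i^ (s ℕ.+ k)) (suc m))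
  where
  negate : ∀ k → + (m C k) * Im-i^ (2 ℕ.+ s ℕ.+ k) ≡ - (+ (m C k) * Im-i^ (s ℕ.+ k))
  negate k = trans (cong (_*_ (+ (m C k))) (Im-i^-2+ (s ℕ.+ k))) (sym (ℤ.neg-distribʳ-* (+ (m C k)) _))

-- (1 + i) ^ 2 = 2 i
binomialIm-+2 : ∀ s m → binomialIm s (2 ℕ.+ m) ≡ + 2 * binomialIm (suc s) m
binomialIm-+2 s m = begin
  binomialIm s (2 ℕ.+ m)
    ≡⟨ binomialIm-suc s (suc m) ⟩
  binomialIm s (suc m) + binomialIm (suc s) (suc m)
    ≡⟨ cong₂ _+_ (binomialIm-suc s m) (binomialIm-suc (suc s) m) ⟩
  (binomialIm s m + binomialIm (suc s) m) + (binomialIm (suc s) m + binomialIm (2 ℕ.+ s) m)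
    ≡⟨ cong (λ x → (binomialIm s m + binomialIm (suc s) m) + (binomialIm (suc s) m + x)) (binomialIm-2+ s m) ⟩
  (binomialIm s m + binomialIm (suc s) m) + (binomialIm (suc s) m + - binomialIm s m)
    ≡⟨ cancel (binomialIm s m) (binomialIm (suc s) m) ⟩
  + 2 * binomialIm (suc s) m ∎
  where
  cancel : ∀ a b → (a + b) + (b + - a) ≡ + 2 * b
  cancel = solve-∀

binomialIm-2* : ∀ s m → binomialIm s (2 ℕ.* m) ≡ + (2 ℕ.^ m) * Im-i^ (s ℕ.+ m)
binomialIm-2* s zero    = ℤ.+-identityʳ _
binomialIm-2* s (suc m) = begin
  binomialIm s (2 ℕ.* suc m)                     ≡⟨ cong (binomialIm s) (ℕ.*-suc 2 m) ⟩
  binomialIm s (2 ℕ.+ 2 ℕ.* m)                   ≡⟨ binomialIm-+2 s (2 ℕ.* m) ⟩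
  + 2 * binomialIm (suc s) (2 ℕ.* m)             ≡⟨ cong (_*_ (+ 2)) (binomialIm-2* (suc s) m) ⟩
  + 2 * (+ (2 ℕ.^ m) * Im-i^ (suc s ℕ.+ m))      ≡⟨ sym (ℤ.*-assoc (+ 2) (+ (2 ℕ.^ m)) _) ⟩
  + 2 * + (2 ℕ.^ m) * Im-i^ (suc s ℕ.+ m)        ≡⟨ cong (_* Im-i^ (suc s ℕ.+ m)) (sym (ℤ.pos-* 2 (2 ℕ.^ m))) ⟩
  + (2 ℕ.^ suc m) * Im-i^ (suc s ℕ.+ m)          ≡⟨ cong (λ i → + (2 ℕ.^ suc m) * Im-i^ i) (sym (ℕ.+-suc s m)) ⟩
  + (2 ℕ.^ suc m) * Im-i^ (s ℕ.+ suc m)          ∎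

binomialIm-odd-terms : ∀ t m → binomialIm (2 ℕ.* t) (2 ℕ.* m)
               ≡ ∑[ j < m ] (+ ((2 ℕ.* m) C suc (2 ℕ.* j)) * Im-i^ (2 ℕ.* t ℕ.+ suc (2 ℕ.* j)))
binomialIm-odd-terms t m = begin
  ∑[ k < suc (2 ℕ.* m) ] F k                             ≡⟨ ∑-init-last F (2 ℕ.* m) ⟩
  ∑[ k < 2 ℕ.* m ] F k + F (2 ℕ.* m)                     ≡⟨ cong (_+_ (∑[ k < 2 ℕ.* m ] F k)) (F-even m) ⟩
  ∑[ k < 2 ℕ.* m ] F k + 0ℤ                              ≡⟨ ℤ.+-identityʳ _ ⟩
  ∑[ k < 2 ℕ.* m ] F k                                   ≡⟨ ∑-pairs F m ⟩
  ∑[ j < m ] (F (2 ℕ.* j) + F (suc (2 ℕ.* j)))           ≡⟨ ∑-cong m (λ j → cong (_+ F (suc (2 ℕ.* j))) (F-even j)) ⟩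
  ∑[ j < m ] (0ℤ + F (suc (2 ℕ.* j)))                    ≡⟨ ∑-cong m (λ j → ℤ.+-identityˡ (F (suc (2 ℕ.* j)))) ⟩
  ∑[ j < m ] F (suc (2 ℕ.* j))                           ∎
  where
  F : ℕ → ℤ
  F k = + ((2 ℕ.* m) C k) * Im-i^ (2 ℕ.* t ℕ.+ k)
  F-even : ∀ q → F (2 ℕ.* q) ≡ 0ℤ
  F-even q = begin
    F (2 ℕ.* q)                    ≡⟨ cong (λ i → + c * Im-i^ i) (sym (ℕ.*-distribˡ-+ 2 t q)) ⟩
    + c * Im-i^ (2 ℕ.* (t ℕ.+ q))  ≡⟨ cong (_*_ (+ c)) (Im-i^-2* (t ℕ.+ q)) ⟩
    + c * 0ℤ                       ≡⟨ ℤ.*-zeroʳ (+ c) ⟩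
    0ℤ                             ∎
    where c = (2 ℕ.* m) C (2 ℕ.* q)

alternating-odd-binomial-sum : ∀ n →
  ∑[ j < suc (2 ℕ.* n) ] (+ ((4 ℕ.* n ℕ.+ 2) C suc (2 ℕ.* j)) * Im-i^ (2 ℕ.* n ℕ.+ suc (2 ℕ.* j)))
  ≡ + (2 ℕ.^ (2 ℕ.* n ℕ.+ 1))
alternating-odd-binomial-sum n = begin
  ∑[ j < M ] (+ ((4 ℕ.* n ℕ.+ 2) C suc (2 ℕ.* j)) * Im-i^ (2 ℕ.* n ℕ.+ suc (2 ℕ.* j)))
    ≡⟨ cong (λ N → ∑[ j < M ] (+ (N C suc (2 ℕ.* j)) * Im-i^ (2 ℕ.* n ℕ.+ suc (2 ℕ.* j)))) (4n+2≡2*[1+2n] n) ⟩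
  ∑[ j < M ] (+ ((2 ℕ.* M) C suc (2 ℕ.* j)) * Im-i^ (2 ℕ.* n ℕ.+ suc (2 ℕ.* j)))
    ≡⟨ sym (binomialIm-odd-terms n M) ⟩
  binomialIm (2 ℕ.* n) (2 ℕ.* M)
    ≡⟨ binomialIm-2* (2 ℕ.* n) M ⟩
  + (2 ℕ.^ M) * Im-i^ (2 ℕ.* n ℕ.+ M)
    ≡⟨ cong₂ (λ e i → + (2 ℕ.^ e) * Im-i^ i) (ℕ.+-comm 1 (2 ℕ.* n)) (2n+[1+2n]≡4n+1 n) ⟩
  + (2 ℕ.^ (2 ℕ.* n ℕ.+ 1)) * Im-i^ (4 ℕ.* n ℕ.+ 1)
    ≡⟨ cong (_*_ (+ (2 ℕ.^ (2 ℕ.* n ℕ.+ 1)))) (Im-i^-4*+ n 1) ⟩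
  + (2 ℕ.^ (2 ℕ.* n ℕ.+ 1)) * 1ℤ
    ≡⟨ ℤ.*-identityʳ _ ⟩
  + (2 ℕ.^ (2 ℕ.* n ℕ.+ 1)) ∎
  where
  M = suc (2 ℕ.* n)
  4n+2≡2*[1+2n] : ∀ n → 4 ℕ.* n ℕ.+ 2 ≡ 2 ℕ.* suc (2 ℕ.* n)
  4n+2≡2*[1+2n] = ℕ-Solver.solve-∀
  2n+[1+2n]≡4n+1 : ∀ n → 2 ℕ.* n ℕ.+ suc (2 ℕ.* n) ≡ 4 ℕ.* n ℕ.+ 1
  2n+[1+2n]≡4n+1 = ℕ-Solver.solve-∀

toℚᵘ-/ : ∀ x d .{{_ : NonZero d}} → toℚᵘ (x / d) ℚᵘ.≃ (x ℚᵘ./ d)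
toℚᵘ-/ x (suc d) = toℚᵘ-fromℚᵘ (mkℚᵘ x d)

/-cross : ∀ x y a b .{{_ : NonZero a}} .{{_ : NonZero b}} → x * + b ≡ y * + a → x / a ≡ y / b
/-cross x y a@(suc _) b@(suc _) eq =
  toℚᵘ-injective (ℚᵘ.≃-trans (toℚᵘ-/ x a) (ℚᵘ.≃-trans (*≡* eq) (ℚᵘ.≃-sym (toℚᵘ-/ y b))))

/-distribʳ-+ : ∀ x y d .{{_ : NonZero d}} → (x + y) / d ≡ x / d ℚ.+ y / d
/-distribʳ-+ x y d@(suc _) = toℚᵘ-injective (ℚᵘ.≃-trans (toℚᵘ-/ (x + y) d) (ℚᵘ.≃-trans (*≡* cross)
  (ℚᵘ.≃-sym (ℚᵘ.≃-trans (toℚᵘ-homo-+ (x / d) (y / d)) (ℚᵘ.+-cong (toℚᵘ-/ x d) (toℚᵘ-/ y d))))))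
  where
  cross : (x + y) * + (d ℕ.* d) ≡ (x * + d + y * + d) * + d
  cross = trans (cong (_*_ (x + y)) (ℤ.pos-* d d)) (distrib x y (+ d))
    where
    distrib : ∀ x y d → (x + y) * (d * d) ≡ (x * d + y * d) * d
    distrib = solve-∀

/1-*-/ : ∀ z x d .{{_ : NonZero d}} → (z / 1) ℚ.* (x / d) ≡ (z * x) / d
/1-*-/ z x d@(suc _) = toℚᵘ-injective (ℚᵘ.≃-trans (toℚᵘ-homo-* (z / 1) (x / d))
  (ℚᵘ.≃-trans (ℚᵘ.*-cong (toℚᵘ-/ z 1) (toℚᵘ-/ x d))
  (ℚᵘ.≃-trans (*≡* (cong (λ e → z * x * + e) (sym (ℕ.*-identityˡ d)))) (ℚᵘ.≃-sym (toℚᵘ-/ (z * x) d)))))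

nCk*k![n∸k]!≡n! : ∀ {n k} → k ≤ n → (n C k) ℕ.* (k ! ℕ.* (n ∸ k) !) ≡ n !
nCk*k![n∸k]!≡n! {n} {k} k≤n = begin
  (n C k) ℕ.* (k ! ℕ.* (n ∸ k) !)                  ≡⟨ cong (ℕ._* (k ! ℕ.* (n ∸ k) !)) (nCk≡n!/k![n-k]! k≤n) ⟩
  n ! ℕ./ (k ! ℕ.* (n ∸ k) !) ℕ.* (k ! ℕ.* (n ∸ k) !) ≡⟨ m/n*n≡m (k![n∸k]!∣n! k≤n) ⟩
  n !                                            ∎
  where instance _ = k !* (n ∸ k) !≢0

1/[k!*[n∸k]!]≡nCk/n! : ∀ {n k} → k ≤ n →
  (+ 1 / (k ! ℕ.* (n ∸ k) !)) {{k !* (n ∸ k) !≢0}} ≡ (+ (n C k) / n !) {{n !≢0}}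
1/[k!*[n∸k]!]≡nCk/n! {n} {k} k≤n = /-cross (+ 1) (+ (n C k)) (k ! ℕ.* (n ∸ k) !) (n !) (begin
  + 1 * + (n !)                                  ≡⟨ ℤ.*-identityˡ (+ (n !)) ⟩
  + (n !)                                        ≡⟨ cong +_ (sym (nCk*k![n∸k]!≡n! k≤n)) ⟩
  + ((n C k) ℕ.* (k ! ℕ.* (n ∸ k) !))              ≡⟨ ℤ.pos-* (n C k) _ ⟩
  + (n C k) * + (k ! ℕ.* (n ∸ k) !)              ∎)
  where instance
  _ = k !* (n ∸ k) !≢0
  _ = n !≢0

sumℚ-map-/ : ∀ (h : ℕ → ℚ) (g : ℕ → ℤ) d .{{_ : NonZero d}} f m →
             (∀ k → k < m → h (f k) ≡ g k / d) → sumℚ (map h (applyUpTo f m)) ≡ (∑[ k < m ] g k) / d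
sumℚ-map-/ h g d f zero    _  = sym (0/n≡0 d)
sumℚ-map-/ h g d f (suc m) eq = begin
  h (f 0) ℚ.+ sumℚ (map h (applyUpTo (f ∘ suc) m))
    ≡⟨ cong₂ ℚ._+_ (eq 0 ℕ.z<s) (sumℚ-map-/ h (g ∘ suc) d (f ∘ suc) m (λ k k<m → eq (suc k) (ℕ.s<s k<m))) ⟩
  g 0 / d ℚ.+ (∑[ k < m ] g (suc k)) / d
    ≡⟨ sym (/-distribʳ-+ (g 0) (∑[ k < m ] g (suc k)) d) ⟩
  (∑[ k < suc m ] g k) / d ∎

signℤ-+ : ∀ k → signℤ (+ k) ≡ Im-i^ (suc (2 ℕ.* k)) / 1
signℤ-+ 0             = refl
signℤ-+ 1             = refl
signℤ-+ (suc (suc k)) = trans (signℤ-+ k) (cong (λ i → Im-i^ i / 1) (sym (1+2*[2+k] k)))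
  where
  1+2*[2+k] : ∀ k → suc (2 ℕ.* (2 ℕ.+ k)) ≡ 4 ℕ.+ suc (2 ℕ.* k)
  1+2*[2+k] = ℕ-Solver.solve-∀

signℤ-⊖ : ∀ j n → signℤ (j ⊖ n) ≡ Im-i^ (2 ℕ.* n ℕ.+ suc (2 ℕ.* j)) / 1
signℤ-⊖ j       zero    = signℤ-+ j
signℤ-⊖ zero    (suc n) = trans (signℤ-+ (suc n)) (cong (λ i → Im-i^ i / 1) (ℕ.+-comm 1 (2 ℕ.* suc n)))
signℤ-⊖ (suc j) (suc n) = begin
  signℤ (suc j ⊖ suc n)                              ≡⟨ cong signℤ (ℤ.[1+m]⊖[1+n]≡m⊖n j n) ⟩
  signℤ (j ⊖ n)                                      ≡⟨ signℤ-⊖ j n ⟩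
  Im-i^ (2 ℕ.* n ℕ.+ suc (2 ℕ.* j)) / 1              ≡⟨ cong (λ i → Im-i^ i / 1) (sym (shift j n)) ⟩
  Im-i^ (2 ℕ.* suc n ℕ.+ suc (2 ℕ.* suc j)) / 1      ∎
  where
  shift : ∀ j n → 2 ℕ.* suc n ℕ.+ suc (2 ℕ.* suc j) ≡ 4 ℕ.+ (2 ℕ.* n ℕ.+ suc (2 ℕ.* j))
  shift = ℕ-Solver.solve-∀

+[1+2*] : ∀ k → + suc (2 ℕ.* k) ≡ + 1 + + 2 * + k
+[1+2*] k = trans (ℤ.pos-+ 1 (2 ℕ.* k)) (cong (_+_ (+ 1)) (ℤ.pos-* 2 k))

module _ (n j : ℕ) where

  2n+2[j-n]+1≡1+2j : + (2 ℕ.* n) + + 2 * (+ j - + n) + + 1 ≡ + suc (2 ℕ.* j)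
  2n+2[j-n]+1≡1+2j = begin
    + (2 ℕ.* n) + + 2 * (+ j - + n) + + 1     ≡⟨ cong (λ x → x + + 2 * (+ j - + n) + + 1) (ℤ.pos-* 2 n) ⟩
    + 2 * + n + + 2 * (+ j - + n) + + 1       ≡⟨ ring (+ n) (+ j) ⟩
    + 1 + + 2 * + j                           ≡⟨ sym (+[1+2*] j) ⟩
    + suc (2 ℕ.* j)                           ∎
    where
    ring : ∀ n j → + 2 * n + + 2 * (j - n) + + 1 ≡ + 1 + + 2 * j
    ring = solve-∀

  2n-2[j-n]+1≡4n+2-[1+2j] : + (2 ℕ.* n) - + 2 * (+ j - + n) + + 1 ≡ + (4 ℕ.* n ℕ.+ 2) - + suc (2 ℕ.* j)
  2n-2[j-n]+1≡4n+2-[1+2j] = begin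
    + (2 ℕ.* n) - + 2 * (+ j - + n) + + 1     ≡⟨ cong (λ x → x - + 2 * (+ j - + n) + + 1) (ℤ.pos-* 2 n) ⟩
    + 2 * + n - + 2 * (+ j - + n) + + 1       ≡⟨ ring (+ n) (+ j) ⟩
    (+ 4 * + n + + 2) - (+ 1 + + 2 * + j)     ≡⟨ sym (cong₂ _-_ +[4n+2] (+[1+2*] j)) ⟩
    + (4 ℕ.* n ℕ.+ 2) - + suc (2 ℕ.* j)       ∎
    where
    ring : ∀ n j → + 2 * n - + 2 * (j - n) + + 1 ≡ (+ 4 * n + + 2) - (+ 1 + + 2 * j)
    ring = solve-∀
    +[4n+2] : + (4 ℕ.* n ℕ.+ 2) ≡ + 4 * + n + + 2
    +[4n+2] = trans (ℤ.pos-+ (4 ℕ.* n) 2) (cong (_+ + 2) (ℤ.pos-* 4 n))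

  1+2j≤4n+2 : j ≤ 2 ℕ.* n → suc (2 ℕ.* j) ≤ 4 ℕ.* n ℕ.+ 2
  1+2j≤4n+2 j≤2n =
    subst (suc (2 ℕ.* j) ≤_) (2+2*[2*n]≡4n+2 n) (ℕ.m≤n⇒m≤1+n (ℕ.s≤s (ℕ.*-monoʳ-≤ 2 j≤2n)))
    where
    2+2*[2*n]≡4n+2 : ∀ n → 2 ℕ.+ 2 ℕ.* (2 ℕ.* n) ≡ 4 ℕ.* n ℕ.+ 2
    2+2*[2*n]≡4n+2 = ℕ-Solver.solve-∀

  ∣2n-2[j-n]+1∣≡4n+2∸[1+2j] : j ≤ 2 ℕ.* n →
    ℤ.∣ + (2 ℕ.* n) - + 2 * (+ j - + n) + + 1 ∣ ≡ 4 ℕ.* n ℕ.+ 2 ∸ suc (2 ℕ.* j)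
  ∣2n-2[j-n]+1∣≡4n+2∸[1+2j] j≤2n = cong ℤ.∣_∣ (begin
    + (2 ℕ.* n) - + 2 * (+ j - + n) + + 1      ≡⟨ 2n-2[j-n]+1≡4n+2-[1+2j] ⟩
    + (4 ℕ.* n ℕ.+ 2) - + suc (2 ℕ.* j)        ≡⟨ ℤ.[+m]-[+n]≡m⊖n (4 ℕ.* n ℕ.+ 2) (suc (2 ℕ.* j)) ⟩
    (4 ℕ.* n ℕ.+ 2) ⊖ suc (2 ℕ.* j)            ≡⟨ ℤ.⊖-≥ (1+2j≤4n+2 j≤2n) ⟩
    + (4 ℕ.* n ℕ.+ 2 ∸ suc (2 ℕ.* j))          ∎)

term-/ : ∀ n j → j < suc (2 ℕ.* n) →
  term n (+ j - + n)
  ≡ ((+ ((4 ℕ.* n ℕ.+ 2) C suc (2 ℕ.* j)) * Im-i^ (2 ℕ.* n ℕ.+ suc (2 ℕ.* j))) / (4 ℕ.* n ℕ.+ 2) !) {{(4 ℕ.* n ℕ.+ 2) !≢0}}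
term-/ n j j<1+2n = begin
  term n (+ j - + n)
    ≡⟨⟩
  signℤ (+ j - + n) ℚ.* (+ 1 / (a ! ℕ.* b !))
    ≡⟨ cong₂ ℚ._*_ sign-eq factorials-eq ⟩
  (σ / 1) ℚ.* (+ (N C suc (2 ℕ.* j)) / N !)
    ≡⟨ /1-*-/ σ (+ (N C suc (2 ℕ.* j))) (N !) ⟩
  (σ * + (N C suc (2 ℕ.* j))) / N !
    ≡⟨ cong (_/ N !) (ℤ.*-comm σ (+ (N C suc (2 ℕ.* j)))) ⟩
  (+ (N C suc (2 ℕ.* j)) * σ) / N ! ∎
  where
  N = 4 ℕ.* n ℕ.+ 2
  σ = Im-i^ (2 ℕ.* n ℕ.+ suc (2 ℕ.* j))
  a = ℤ.∣ + (2 ℕ.* n) + + 2 * (+ j - + n) + + 1 ∣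
  b = ℤ.∣ + (2 ℕ.* n) - + 2 * (+ j - + n) + + 1 ∣
  instance
    _ = a !* b !≢0
    _ = N !≢0
  j≤2n : j ≤ 2 ℕ.* n
  j≤2n = ℕ.s≤s⁻¹ j<1+2n
  sign-eq : signℤ (+ j - + n) ≡ σ / 1
  sign-eq = trans (cong signℤ (ℤ.[+m]-[+n]≡m⊖n j n)) (signℤ-⊖ j n)
  a≡1+2j : a ≡ suc (2 ℕ.* j)
  a≡1+2j = cong ℤ.∣_∣ (2n+2[j-n]+1≡1+2j n j)
  b≡N∸[1+2j] : b ≡ N ∸ suc (2 ℕ.* j)
  b≡N∸[1+2j] = ∣2n-2[j-n]+1∣≡4n+2∸[1+2j] n j j≤2n
  factorials-eq : + 1 / (a ! ℕ.* b !) ≡ + (N C suc (2 ℕ.* j)) / N !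
  factorials-eq = begin
    + 1 / (a ! ℕ.* b !)
      ≡⟨ cong₂ (λ a b → (+ 1 / (a ! ℕ.* b !)) {{a !* b !≢0}}) a≡1+2j b≡N∸[1+2j] ⟩
    (+ 1 / (suc (2 ℕ.* j) ! ℕ.* (N ∸ suc (2 ℕ.* j)) !)) {{suc (2 ℕ.* j) !* (N ∸ suc (2 ℕ.* j)) !≢0}}
      ≡⟨ 1/[k!*[n∸k]!]≡nCk/n! (1+2j≤4n+2 n j j≤2n) ⟩
    + (N C suc (2 ℕ.* j)) / N ! ∎

mainTheorem6 : (n : ℕ) → LHS n ≡ RHS n
mainTheorem6 n = begin
  sumℚ (map (term n) (map (λ j → + j - + n) (upTo M)))
    ≡⟨ cong sumℚ (sym (map-∘ {g = term n} {f = λ j → + j - + n} (upTo M))) ⟩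
  sumℚ (map (term n ∘ λ j → + j - + n) (upTo M))
    ≡⟨ sumℚ-map-/ (term n ∘ λ j → + j - + n) summand (N !) id M (term-/ n) ⟩
  (∑[ j < M ] summand j) / N !
    ≡⟨ cong (_/ N !) (alternating-odd-binomial-sum n) ⟩
  + (2 ℕ.^ (2 ℕ.* n ℕ.+ 1)) / N ! ∎
  where
  M = suc (2 ℕ.* n)
  N = 4 ℕ.* n ℕ.+ 2
  instance _ = N !≢0
  summand : ℕ → ℤ
  summand j = + (N C suc (2 ℕ.* j)) * Im-i^ (2 ℕ.* n ℕ.+ suc (2 ℕ.* j))
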